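{- Let $D$ be a finite homomorphism-homogeneous reflexive improper bidirectionally disconnected digraph, and let $S,T$ be distinct classes of $\theta(D)$ with $S\rightleftarrows T$. Then: (1) $\gamma_T(S)$ is an equivalence relation on $S$; (2) $(x,y)\in\gamma_T(S)$ iff for all $t\in T$, ($x\to t$ and $y\to t$) or ($t\to x$ and $t\to y$); (3) $(x,y)\in\gamma_T(S)$ iff there exists $t\in T$ with ($x\to t$ and $y\to t$) or ($t\to x$ and $t\to y$); (4) $\gamma_T(S)$ has exactly two blocks; (5) if $S/\gamma_T(S)=\{S_1,S_2\}$ and $T/\gamma_S(T)=\{T_1,T_2\}$, then $S_1\rightrightarrows T_1\rightrightarrows S_2\rightrightarrows T_2\rightrightarrows S_1$ or $T_1\rightrightarrows S_1\rightrightarrows T_2\rightrightarrows S_2\rightrightarrows T_1$.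
   Context: Digraph $D=(V,E)$, $V$ finite; $x\to y$ means $(x,y)\in E$; $x\rightleftarrows y$: both directions. Reflexive: all loops; improper: $E$ neither symmetric nor antisymmetric. For nonempty $X,Y\subseteq V$: $X\to Y$ means some $x\in X,y\in Y$ with $x\to y$; $X\rightleftarrows Y$: $X\to Y$ and $Y\to X$; $X\rightrightarrows Y$: $x\to y$ for all $x\in X,y\in Y$. Homomorphism-homogeneous: every homomorphism $D[U]\to D[W]$ between induced subdigraphs ($U,W$ nonempty) extends to an endomorphism. $\omega(D)$: number of weak components; $(x,y)\in\theta(D)$ iff $x=y$ or $x=z_1\rightleftarrows\cdots\rightleftarrows z_k=y$; bidirectionally disconnected: $\omega(D)<|V/\theta(D)|$. For distinct $\theta(D)$-classes $S,T$ with $S\rightleftarrows T$, the relation $\gamma_T(S)\subseteq S^2$ is defined by: $(x,y)\in\gamma_T(S)$ iff there is no $t\in T$ with $x\to t\to y$ or $y\to t\to x$. -}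

module Defs where

open import Level using (0ℓ)
open import Data.Nat using (ℕ; _<_)
open import Data.Fin using (Fin)
open import Data.Bool using (Bool; true)
open import Data.Product using (Σ; ∃; _×_; _,_; proj₁)
open import Data.Sum using (_⊎_)
open import Relation.Nullary using (¬_)
open import Relation.Binary.PropositionalEquality using (_≡_)
open import Relation.Binary.Construct.Closure.ReflexiveTransitive using (Star)
open import Function.Bundles using (_⇔_)

Digraph : ℕ → Set
Digraph n = Fin n → Fin n → Bool

Edge : ∀ {n} → Digraph n → Fin n → Fin n → Set
Edge D x y = D x y ≡ true

Reflexive : ∀ {n} → Digraph n → Set
Reflexive D = ∀ x → Edge D x x

Improper : ∀ {n} → Digraph n → Set
Improper D = ¬ (∀ x y → Edge D x y → Edge D y x)
           × ¬ (∀ x y → Edge D x y → Edge D y x → x ≡ y)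

Pred : ℕ → Set₁
Pred n = Fin n → Set

Nonempty : ∀ {n} → Pred n → Set
Nonempty U = ∃ λ x → U x

IsHomUW : ∀ {n} → Digraph n → Pred n → Pred n → (Fin n → Fin n) → Set
IsHomUW D U W f = (∀ u → U u → W (f u))
                × (∀ u v → U u → U v → Edge D u v → Edge D (f u) (f v))

IsEndo : ∀ {n} → Digraph n → (Fin n → Fin n) → Set
IsEndo D g = ∀ x y → Edge D x y → Edge D (g x) (g y)

-- every homomorphism between nonempty induced subdigraphs extends to an endomorphism
-- (a map defined on U is represented by any total function agreeing with it on U)
HomHomogeneous : ∀ {n} → Digraph n → Set₁
HomHomogeneous {n} D = ∀ (U W : Pred n) → Nonempty U → Nonempty W →
  ∀ (f : Fin n → Fin n) → IsHomUW D U W f →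
  ∃ λ (g : Fin n → Fin n) → IsEndo D g × (∀ u → U u → g u ≡ f u)

NumClasses : ∀ {A : Set} → (A → A → Set) → ℕ → Set
NumClasses {A} R k = Σ (A → Fin k) λ c →
  (∀ i → ∃ λ a → c a ≡ i) × (∀ a b → R a b ⇔ (c a ≡ c b))

WeakStep : ∀ {n} → Digraph n → Fin n → Fin n → Set
WeakStep D x y = Edge D x y ⊎ Edge D y x

WeakConn : ∀ {n} → Digraph n → Fin n → Fin n → Set
WeakConn D = Star (WeakStep D)

BiEdge : ∀ {n} → Digraph n → Fin n → Fin n → Set
BiEdge D x y = Edge D x y × Edge D y x

θ : ∀ {n} → Digraph n → Fin n → Fin n → Set
θ D = Star (BiEdge D)

BidirDisconnected : ∀ {n} → Digraph n → Set
BidirDisconnected D = ∃ λ ω → ∃ λ m →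
  NumClasses (WeakConn D) ω × NumClasses (θ D) m × ω < m

_⟶[_]_ : ∀ {n} → Pred n → Digraph n → Pred n → Set
X ⟶[ D ] Y = ∃ λ x → ∃ λ y → X x × Y y × Edge D x y

_⇄[_]_ : ∀ {n} → Pred n → Digraph n → Pred n → Set
X ⇄[ D ] Y = (X ⟶[ D ] Y) × (Y ⟶[ D ] X)

_⇉[_]_ : ∀ {n} → Pred n → Digraph n → Pred n → Set
X ⇉[ D ] Y = ∀ x y → X x → Y y → Edge D x y

ClassOf : ∀ {n} → Digraph n → Fin n → Pred n
ClassOf D s x = θ D x s

γ : ∀ {n} → Digraph n → (T S : Pred n) → Fin n → Fin n → Set
γ D T S x y = S x × S y ×
  ¬ (∃ λ t → T t × ((Edge D x t × Edge D t y) ⊎ (Edge D y t × Edge D t x)))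

Elem : ∀ {n} → Pred n → Set
Elem {n} S = Σ (Fin n) S

γ↾ : ∀ {n} → Digraph n → (T S : Pred n) → Elem S → Elem S → Set
γ↾ D T S a b = γ D T S (proj₁ a) (proj₁ b)

Block : ∀ {n} → Digraph n → (T S : Pred n) → Fin n → Pred n
Block D T S a x = γ D T S x a

CommonNbr : ∀ {n} → Digraph n → Fin n → Fin n → Fin n → Set
CommonNbr D x y t = (Edge D x t × Edge D y t) ⊎ (Edge D t x × Edge D t y)

-- Homomorphism-homogeneity lets us extend any edge-respecting map on two or three
-- vertices.  Since S and T are distinct θ-classes, no vertex of S is joined to a
-- vertex of T in both directions, and an endomorphism maps S and T into θ-classes.
-- Folding one vertex of S onto another while fixing a vertex of T shows that two
-- vertices of S with a common T-neighbour are never separated by T; with one more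
-- swap this forces every x ∈ S and u ∈ T to be adjacent, so exactly one of x → u,
-- u → x holds.  Then γ_T(S) is the relation "same orientation towards every u ∈ T",
-- which is already decided by a single u ∈ T.  A vertex w ∈ T with both an in- and
-- an out-neighbour in S splits S into exactly two γ-blocks, and the orientation
-- between a block of S and a block of T is that between any two representatives.
module Submission where

open import Defs
open import Data.Nat using (ℕ)
open import Data.Fin using (Fin) renaming (_≟_ to _≟ᶠ_)
open import Data.Fin.Properties using (2↔Bool)
open import Data.Bool using (Bool; true; false; not)
open import Data.Bool.Properties using (not-involutive; not-¬; ¬-not)
open import Data.Product using (∃; _×_; _,_; proj₁; proj₂)
open import Data.Sum using (_⊎_; inj₁; inj₂)
open import Data.Unit using (⊤; tt)
open import Data.Empty using (⊥; ⊥-elim)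
open import Function using (_∘_)
open import Function.Bundles using (_⇔_; _↔_; mk⇔; Equivalence; Inverse; Injection)
open import Function.Properties.Inverse using (↔-sym; ↔⇒↣)
open import Relation.Nullary using (¬_; yes; no)
open import Relation.Binary.PropositionalEquality
open import Relation.Binary.Structures using (IsEquivalence)
open import Relation.Binary.Construct.Closure.ReflexiveTransitive using (ε; _◅_; _◅◅_; gmap; reverse)

NumClasses⇒IsEquivalence : ∀ {A : Set} {R : A → A → Set} {k} → NumClasses R k → IsEquivalence R
NumClasses⇒IsEquivalence (_ , _ , kernel) = record
  { refl  = λ {a} → from (kernel a a) refl
  ; sym   = λ {a} {b} r → from (kernel b a) (sym (to (kernel a b) r))
  ; trans = λ {a} {b} {c′} r r′ →
      from (kernel a c′) (trans (to (kernel a b) r) (to (kernel b c′) r′))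
  }
  where open Equivalence

numClasses-2 : ∀ {A : Set} {R : A → A → Set} (f : A → Bool) →
               (∀ b → ∃ λ a → f a ≡ b) → (∀ a a′ → R a a′ ⇔ (f a ≡ f a′)) → NumClasses R 2
numClasses-2 f f-onto kernel =
    Inverse.to bool↔2 ∘ f
  , (λ i → let (a , fa≡) = f-onto (Inverse.from bool↔2 i)
           in a , trans (cong (Inverse.to bool↔2) fa≡) (Inverse.strictlyInverseˡ bool↔2 i))
  , λ a a′ → mk⇔ (cong (Inverse.to bool↔2) ∘ Equivalence.to (kernel a a′))
                 (Equivalence.from (kernel a a′) ∘ Injection.injective (↔⇒↣ bool↔2))
  where
  bool↔2 : Bool ↔ Fin 2
  bool↔2 = ↔-sym 2↔Bool

module _ {n : ℕ} {D : Digraph n} where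

  θ-sym : ∀ {x y} → θ D x y → θ D y x
  θ-sym = reverse (λ (xy , yx) → yx , xy)

  endo-edge : ∀ {g} → IsEndo D g → ∀ {a b a′ b′} → g a ≡ a′ → g b ≡ b′ → Edge D a b → Edge D a′ b′
  endo-edge g-endo refl refl = g-endo _ _

  endo-θ : ∀ {g} → IsEndo D g → ∀ {a b a′ b′} → g a ≡ a′ → g b ≡ b′ → θ D a b → θ D a′ b′
  endo-θ {g} g-endo refl refl = gmap g (λ (ab , ba) → g-endo _ _ ab , g-endo _ _ ba)

_[_↦_] : ∀ {n} → (Fin n → Fin n) → Fin n → Fin n → Fin n → Fin n
(h [ p ↦ c ]) z with z ≟ᶠ p
... | yes _ = c
... | no  _ = h z

[↦]-here : ∀ {n} (h : Fin n → Fin n) p c → (h [ p ↦ c ]) p ≡ c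
[↦]-here h p c with p ≟ᶠ p
... | yes _   = refl
... | no  p≢p = ⊥-elim (p≢p refl)

[↦]-there : ∀ {n} (h : Fin n → Fin n) {p z} c → z ≢ p → (h [ p ↦ c ]) z ≡ h z
[↦]-there h {p} {z} c z≢p with z ≟ᶠ p
... | yes z≡p = ⊥-elim (z≢p z≡p)
... | no  _   = refl

module Homogeneous {n : ℕ} (D : Digraph n) (hh : HomHomogeneous D) (rf : Reflexive D) where

  private
    E : Fin n → Fin n → Set
    E = Edge D

    edge-≡ : ∀ {a b a′ b′} → a ≡ a′ → b ≡ b′ → E a′ b′ → E a b
    edge-≡ refl refl e = e

  extend : ∀ (U : Pred n) {p} → U p → (f : Fin n → Fin n) →
           (∀ u v → U u → U v → E u v → E (f u) (f v)) →
           ∃ λ g → IsEndo D g × (∀ u → U u → g u ≡ f u)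
  extend U {p} Up f f-hom = hh U (λ _ → ⊤) (p , Up) (p , tt) f ((λ _ _ → tt) , f-hom)

  extend-pair : ∀ {p q} c d → p ≢ q → (E p q → E c d) → (E q p → E d c) →
                ∃ λ g → IsEndo D g × g p ≡ c × g q ≡ d
  extend-pair {p} {q} c d p≢q pq⇒cd qp⇒dc =
    let g , g-endo , g≗f = extend (λ z → z ≡ p ⊎ z ≡ q) (inj₁ refl) f f-hom
    in  g , g-endo , trans (g≗f p (inj₁ refl)) fp , trans (g≗f q (inj₂ refl)) fq
    where
    f : Fin n → Fin n
    f = (λ _ → d) [ p ↦ c ]
    fp : f p ≡ c
    fp = [↦]-here _ p c
    fq : f q ≡ d
    fq = [↦]-there _ c (p≢q ∘ sym)
    f-hom : ∀ u v → u ≡ p ⊎ u ≡ q → v ≡ p ⊎ v ≡ q → E u v → E (f u) (f v)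
    f-hom _ _ (inj₁ refl) (inj₁ refl) _  = edge-≡ fp fp (rf c)
    f-hom _ _ (inj₁ refl) (inj₂ refl) pq = edge-≡ fp fq (pq⇒cd pq)
    f-hom _ _ (inj₂ refl) (inj₁ refl) qp = edge-≡ fq fp (qp⇒dc qp)
    f-hom _ _ (inj₂ refl) (inj₂ refl) _  = edge-≡ fq fq (rf d)

  fold-onto : ∀ p q r → r ≢ p → (E p r → E q r) → (E r p → E r q) →
              ∃ λ g → IsEndo D g × g p ≡ q × g q ≡ q × g r ≡ r
  fold-onto p q r r≢p pr⇒qr rp⇒rq =
    let g , g-endo , g≗f = extend (λ z → z ≡ p ⊎ z ≡ q ⊎ z ≡ r) (inj₁ refl) f f-hom
    in  g , g-endo , trans (g≗f p (inj₁ refl)) fp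
                   , trans (g≗f q (inj₂ (inj₁ refl))) fq
                   , trans (g≗f r (inj₂ (inj₂ refl))) ([↦]-there _ q r≢p)
    where
    f : Fin n → Fin n
    f = (λ z → z) [ p ↦ q ]
    fp : f p ≡ q
    fp = [↦]-here _ p q
    fq : f q ≡ q
    fq with q ≟ᶠ p
    ... | yes _ = refl
    ... | no  _ = refl
    -- outside p the map is the identity, so only edges at p need checking
    moved : ∀ v → v ≡ p ⊎ v ≡ q ⊎ v ≡ r → v ≢ p → (E p v → E q v) × (E v p → E v q)
    moved _ (inj₁ refl)        v≢p = ⊥-elim (v≢p refl)
    moved _ (inj₂ (inj₁ refl)) _   = (λ _ → rf q) , (λ _ → rf q)
    moved _ (inj₂ (inj₂ refl)) _   = pr⇒qr , rp⇒rq
    f-hom : ∀ u v → u ≡ p ⊎ u ≡ q ⊎ u ≡ r → v ≡ p ⊎ v ≡ q ⊎ v ≡ r → E u v → E (f u) (f v)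
    f-hom u v Uu Uv uv with u ≟ᶠ p | v ≟ᶠ p
    ... | yes refl | yes refl = rf q
    ... | yes refl | no  v≢p  = proj₁ (moved v Uv v≢p) uv
    ... | no  u≢p  | yes refl = proj₂ (moved u Uu u≢p) uv
    ... | no  _    | no  _    = uv

  module Pair (s t : Fin n) (s≁t : ¬ θ D s t)
              (S⇄T : ClassOf D s ⇄[ D ] ClassOf D t) where

    S T : Pred n
    S = ClassOf D s
    T = ClassOf D t

    Separator : Fin n → Fin n → Fin n → Set
    Separator u x y = (E x u × E u y) ⊎ (E y u × E u x)

    no-biedge : ∀ {x u} → S x → T u → E x u → E u x → ⊥
    no-biedge Sx Tu xu ux = s≁t (θ-sym Sx ◅◅ ((xu , ux) ◅ ε) ◅◅ Tu)

    S≢T : ∀ {x u} → S x → T u → x ≢ u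
    S≢T Sx Tu refl = s≁t (θ-sym Sx ◅◅ Tu)

    endo-T : ∀ {g u v} → IsEndo D g → g u ≡ u → T u → T v → T (g v)
    endo-T g-endo gu≡u Tu Tv = endo-θ g-endo refl gu≡u (Tv ◅◅ θ-sym Tu) ◅◅ Tu

    -- Folding x onto y (fixing y and u) turns a separator x → v → y into y ⇄ h v.
    fold-γ : ∀ {x y u} → S x → S y → T u → (E x u → E y u) → (E u x → E u y) → γ D T S x y
    fold-γ {x} {y} {u} Sx Sy Tu xu⇒yu ux⇒uy = Sx , Sy , separated
      where
      separated : ¬ ∃ λ v → T v × Separator v x y
      separated (v , Tv , sep) with fold-onto x y u (S≢T Sx Tu ∘ sym) xu⇒yu ux⇒uy
      ... | h , h-endo , hx≡y , hy≡y , hu≡u with sep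
      ...   | inj₁ (xv , vy) = no-biedge Sy (endo-T h-endo hu≡u Tu Tv)
                                 (endo-edge h-endo hx≡y refl xv) (endo-edge h-endo refl hy≡y vy)
      ...   | inj₂ (yv , vx) = no-biedge Sy (endo-T h-endo hu≡u Tu Tv)
                                 (endo-edge h-endo hy≡y refl yv) (endo-edge h-endo refl hx≡y vx)

    neighbour-in-T : ∀ {x} → S x → ∃ λ v → T v × (E x v ⊎ E v x)
    neighbour-in-T {x} Sx with proj₁ S⇄T
    ... | a , b , Sa , Tb , ab with D x b in xb | D b x in bx
    ...   | true  | _    = b , Tb , inj₁ xb
    ...   | false | true = b , Tb , inj₂ bx
    ...   | false | false
      with extend-pair b x (S≢T Sx Tb) (⊥-elim ∘ not-¬ xb) (⊥-elim ∘ not-¬ bx)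
    ...     | g , g-endo , gx≡b , gb≡x =
      g a , endo-θ g-endo refl gx≡b (Sa ◅◅ θ-sym Sx) ◅◅ Tb , inj₂ (endo-edge g-endo refl gb≡x ab)

    -- A vertex u ∈ T not adjacent to x could have x folded onto any vertex of S,
    -- e.g. onto g v; but the T-neighbour v of x separates x from g v.
    S-T-adjacent : ∀ {x u} → S x → T u → ¬ E x u → ¬ E u x → ⊥
    S-T-adjacent {x} {u} Sx Tu ¬xu ¬ux with neighbour-in-T Sx
    ... | v , Tv , x~v with extend-pair v x (S≢T Sx Tu) (⊥-elim ∘ ¬xu) (⊥-elim ∘ ¬ux)
    ...   | g , g-endo , gx≡v , gu≡x =
      proj₂ (proj₂ (fold-γ Sx Sgv Tu (⊥-elim ∘ ¬xu) (⊥-elim ∘ ¬ux))) (v , Tv , separator x~v)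
      where
      Sgv : S (g v)
      Sgv = endo-θ g-endo refl gu≡x (Tv ◅◅ θ-sym Tu) ◅◅ Sx
      separator : E x v ⊎ E v x → Separator v x (g v)
      separator (inj₁ xv) = inj₁ (xv , endo-edge g-endo gx≡v refl xv)
      separator (inj₂ vx) = inj₂ (endo-edge g-endo refl gx≡v vx , vx)

    T→S-edge : ∀ {x u} → S x → T u → D u x ≡ not (D x u)
    T→S-edge {x} {u} Sx Tu with D x u in xu | D u x in ux
    ... | true  | true  = ⊥-elim (no-biedge Sx Tu xu ux)
    ... | true  | false = refl
    ... | false | true  = refl
    ... | false | false = ⊥-elim (S-T-adjacent Sx Tu (not-¬ xu) (not-¬ ux))

    S→T-edge : ∀ {x u} → S x → T u → D x u ≡ not (D u x)
    S→T-edge Sx Tu = trans (sym (not-involutive _)) (cong not (sym (T→S-edge Sx Tu)))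

    γ-intro : ∀ {x y u} → S x → S y → T u → D x u ≡ D y u → γ D T S x y
    γ-intro {x} {y} {u} Sx Sy Tu xu≡yu = fold-γ Sx Sy Tu (trans (sym xu≡yu)) ux⇒uy
      where
      ux⇒uy : E u x → E u y
      ux⇒uy ux = begin
        D u y       ≡⟨ T→S-edge Sy Tu ⟩
        not (D y u) ≡⟨ cong not (sym xu≡yu) ⟩
        not (D x u) ≡⟨ sym (T→S-edge Sx Tu) ⟩
        D u x       ≡⟨ ux ⟩
        true        ∎
        where open ≡-Reasoning

    γ-elim : ∀ {x y u} → γ D T S x y → T u → D x u ≡ D y u
    γ-elim {x} {y} {u} (Sx , Sy , unseparated) Tu with D x u in xu | D y u in yu
    ... | true  | true  = refl
    ... | false | false = refl
    ... | true  | false = ⊥-elim (unseparated (u , Tu , inj₁ (xu , trans (T→S-edge Sy Tu) (cong not yu))))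
    ... | false | true  = ⊥-elim (unseparated (u , Tu , inj₂ (yu , trans (T→S-edge Sx Tu) (cong not xu))))

    commonNbr⇔same-orientation : ∀ {x y u} → S x → S y → T u → CommonNbr D x y u ⇔ (D x u ≡ D y u)
    commonNbr⇔same-orientation {x} {y} {u} Sx Sy Tu = mk⇔ to from
      where
      to : CommonNbr D x y u → D x u ≡ D y u
      to (inj₁ (xu , yu)) = trans xu (sym yu)
      to (inj₂ (ux , uy)) = begin
        D x u       ≡⟨ S→T-edge Sx Tu ⟩
        not (D u x) ≡⟨ cong not (trans ux (sym uy)) ⟩
        not (D u y) ≡⟨ sym (S→T-edge Sy Tu) ⟩
        D y u       ∎
        where open ≡-Reasoning
      from : D x u ≡ D y u → CommonNbr D x y u
      from xu≡yu with D x u in xu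
      ... | true  = inj₁ (refl , sym xu≡yu)
      ... | false = inj₂ ( trans (T→S-edge Sx Tu) (cong not xu)
                         , trans (T→S-edge Sy Tu) (cong not (sym xu≡yu)) )

    γ⇔commonNbr-everywhere : ∀ x y → S x → S y → γ D T S x y ⇔ (∀ u → T u → CommonNbr D x y u)
    γ⇔commonNbr-everywhere x y Sx Sy = mk⇔
      (λ x≈y u Tu → Equivalence.from (commonNbr⇔same-orientation Sx Sy Tu) (γ-elim x≈y Tu))
      (λ common → γ-intro Sx Sy ε (Equivalence.to (commonNbr⇔same-orientation Sx Sy ε) (common t ε)))

    γ⇔commonNbr-somewhere : ∀ x y → S x → S y → γ D T S x y ⇔ (∃ λ u → T u × CommonNbr D x y u)
    γ⇔commonNbr-somewhere x y Sx Sy = mk⇔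
      (λ x≈y → t , ε , Equivalence.from (commonNbr⇔same-orientation Sx Sy ε) (γ-elim x≈y ε))
      (λ (u , Tu , common) → γ-intro Sx Sy Tu (Equivalence.to (commonNbr⇔same-orientation Sx Sy Tu) common))

    ¬γ⇒opposite-orientation : ∀ {x y u} → S x → S y → ¬ γ D T S x y → T u → D y u ≡ not (D x u)
    ¬γ⇒opposite-orientation Sx Sy x≉y Tu = ¬-not (x≉y ∘ γ-intro Sx Sy Tu ∘ sym)

    mixed-vertex : ∃ λ w → T w × (∀ b → ∃ λ x → S x × D x w ≡ b)
    mixed-vertex with proj₁ S⇄T | proj₂ S⇄T
    ... | a , b , Sa , Tb , ab | w , x₀ , Tw , Sx₀ , wx₀ = w , Tw , in-or-out
      where
      x₀w : D x₀ w ≡ false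
      x₀w = trans (S→T-edge Sx₀ Tw) (cong not wx₀)
      in-neighbour : ∃ λ x → S x × D x w ≡ true
      in-neighbour with D a w in aw
      ... | true  = a , Sa , aw
      ... | false
        with extend-pair w x₀ (S≢T Sa Tb) (λ _ → wx₀) (⊥-elim ∘ no-biedge Sa Tb ab)
      ...   | g , g-endo , ga≡w , gb≡x₀ =
        g w , endo-θ g-endo refl gb≡x₀ (Tw ◅◅ θ-sym Tb) ◅◅ Sx₀
            , endo-edge g-endo refl ga≡w (trans (T→S-edge Sa Tw) (cong not aw))
      in-or-out : ∀ b → ∃ λ x → S x × D x w ≡ b
      in-or-out true  = in-neighbour
      in-or-out false = x₀ , Sx₀ , x₀w

    γ-numClasses : NumClasses (γ↾ D T S) 2
    γ-numClasses with mixed-vertex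
    ... | w , Tw , in-or-out = numClasses-2 (λ (x , _) → D x w)
      (λ b → let (x , Sx , xw) = in-or-out b in (x , Sx) , xw)
      (λ (x , Sx) (y , Sy) → mk⇔ (λ x≈y → γ-elim x≈y Tw) (γ-intro Sx Sy Tw))

    γ-isEquivalence : IsEquivalence (γ↾ D T S)
    γ-isEquivalence = NumClasses⇒IsEquivalence γ-numClasses

  module Blocks (s t : Fin n) (s≁t : ¬ θ D s t)
                (S⇄T : ClassOf D s ⇄[ D ] ClassOf D t) where

    private
      module ST = Pair s t s≁t S⇄T
      module TS = Pair t s (s≁t ∘ θ-sym) (proj₂ S⇄T , proj₁ S⇄T)
    open ST using (S; T)

    block-orientation : ∀ {a b x y} → Block D T S a x → Block D S T b y → D x y ≡ D a b
    block-orientation {a} {b} {x} {y} x≈a@(_ , Sa , _) y≈b@(Ty , Tb , _) = begin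
      D x y       ≡⟨ ST.γ-elim x≈a Ty ⟩
      D a y       ≡⟨ ST.S→T-edge Sa Ty ⟩
      not (D y a) ≡⟨ cong not (TS.γ-elim y≈b Sa) ⟩
      not (D b a) ≡⟨ sym (ST.S→T-edge Sa Tb) ⟩
      D a b       ∎
      where open ≡-Reasoning

    S-block⇉T-block : ∀ {a b} → D a b ≡ true → Block D T S a ⇉[ D ] Block D S T b
    S-block⇉T-block ab x y x≈a y≈b = trans (block-orientation x≈a y≈b) ab

    T-block⇉S-block : ∀ {a b} → D b a ≡ true → Block D S T b ⇉[ D ] Block D T S a
    T-block⇉S-block {a} {b} ba y x y≈b x≈a@(Sx , Sa , _) = begin
      D y x       ≡⟨ ST.T→S-edge Sx (proj₁ y≈b) ⟩
      not (D x y) ≡⟨ cong not (block-orientation x≈a y≈b) ⟩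
      not (D a b) ≡⟨ sym (ST.T→S-edge Sa (proj₁ (proj₂ y≈b))) ⟩
      D b a       ≡⟨ ba ⟩
      true        ∎
      where open ≡-Reasoning

    cycle-orientation : ∀ {a₁ a₂ b₁ b₂} → S a₁ → S a₂ → ¬ γ D T S a₁ a₂ →
                        T b₁ → T b₂ → ¬ γ D S T b₁ b₂ →
                        D b₁ a₂ ≡ D a₁ b₁ × D a₂ b₂ ≡ D a₁ b₁ × D b₂ a₁ ≡ D a₁ b₁
    cycle-orientation {a₁} {a₂} {b₁} {b₂} Sa₁ Sa₂ a₁≉a₂ Tb₁ Tb₂ b₁≉b₂ = b₁a₂ , a₂b₂ , b₂a₁
      where
      open ≡-Reasoning
      b₁a₂ : D b₁ a₂ ≡ D a₁ b₁
      b₁a₂ = begin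
        D b₁ a₂             ≡⟨ ST.T→S-edge Sa₂ Tb₁ ⟩
        not (D a₂ b₁)       ≡⟨ cong not (ST.¬γ⇒opposite-orientation Sa₁ Sa₂ a₁≉a₂ Tb₁) ⟩
        not (not (D a₁ b₁)) ≡⟨ not-involutive _ ⟩
        D a₁ b₁             ∎
      b₂a₁ : D b₂ a₁ ≡ D a₁ b₁
      b₂a₁ = begin
        D b₂ a₁             ≡⟨ TS.¬γ⇒opposite-orientation Tb₁ Tb₂ b₁≉b₂ Sa₁ ⟩
        not (D b₁ a₁)       ≡⟨ cong not (ST.T→S-edge Sa₁ Tb₁) ⟩
        not (not (D a₁ b₁)) ≡⟨ not-involutive _ ⟩
        D a₁ b₁             ∎
      a₂b₂ : D a₂ b₂ ≡ D a₁ b₁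
      a₂b₂ = begin
        D a₂ b₂             ≡⟨ ST.¬γ⇒opposite-orientation Sa₁ Sa₂ a₁≉a₂ Tb₂ ⟩
        not (D a₁ b₂)       ≡⟨ cong not (ST.S→T-edge Sa₁ Tb₂) ⟩
        not (not (D b₂ a₁)) ≡⟨ cong (not ∘ not) b₂a₁ ⟩
        not (not (D a₁ b₁)) ≡⟨ not-involutive _ ⟩
        D a₁ b₁             ∎

    blocks-cycle : ∀ a₁ a₂ b₁ b₂ → S a₁ → S a₂ → ¬ γ D T S a₁ a₂ →
          T b₁ → T b₂ → ¬ γ D S T b₁ b₂ →
          let S₁ = Block D T S a₁
              S₂ = Block D T S a₂
              T₁ = Block D S T b₁
              T₂ = Block D S T b₂
          in (S₁ ⇉[ D ] T₁ × T₁ ⇉[ D ] S₂ × S₂ ⇉[ D ] T₂ × T₂ ⇉[ D ] S₁)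
           ⊎ (T₁ ⇉[ D ] S₁ × S₁ ⇉[ D ] T₂ × T₂ ⇉[ D ] S₂ × S₂ ⇉[ D ] T₁)
    blocks-cycle a₁ a₂ b₁ b₂ Sa₁ Sa₂ a₁≉a₂ Tb₁ Tb₂ b₁≉b₂
      with cycle-orientation Sa₁ Sa₂ a₁≉a₂ Tb₁ Tb₂ b₁≉b₂ | D a₁ b₁ in a₁b₁
    ... | b₁a₂ , a₂b₂ , b₂a₁ | true =
      inj₁ ( S-block⇉T-block a₁b₁
           , T-block⇉S-block (trans b₁a₂ a₁b₁)
           , S-block⇉T-block (trans a₂b₂ a₁b₁)
           , T-block⇉S-block (trans b₂a₁ a₁b₁) )
    ... | b₁a₂ , a₂b₂ , b₂a₁ | false =
      inj₂ ( T-block⇉S-block (trans (ST.T→S-edge Sa₁ Tb₁) (cong not a₁b₁))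
           , S-block⇉T-block (trans (ST.S→T-edge Sa₁ Tb₂) (cong not (trans b₂a₁ a₁b₁)))
           , T-block⇉S-block (trans (ST.T→S-edge Sa₂ Tb₂) (cong not (trans a₂b₂ a₁b₁)))
           , S-block⇉T-block (trans (ST.S→T-edge Sa₂ Tb₁) (cong not (trans b₁a₂ a₁b₁))) )

lemma5p9 : ∀ {n : ℕ} (D : Digraph n) →
    HomHomogeneous D → Reflexive D → Improper D → BidirDisconnected D →
    ∀ (s t : Fin n) → ¬ θ D s t →
    ClassOf D s ⇄[ D ] ClassOf D t →
    let S = ClassOf D s
        T = ClassOf D t
    in IsEquivalence (γ↾ D T S)
     × (∀ x y → S x → S y → γ D T S x y ⇔ (∀ u → T u → CommonNbr D x y u))
     × (∀ x y → S x → S y → γ D T S x y ⇔ (∃ λ u → T u × CommonNbr D x y u))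
     × NumClasses (γ↾ D T S) 2
     × (∀ a₁ a₂ b₁ b₂ → S a₁ → S a₂ → ¬ γ D T S a₁ a₂ →
          T b₁ → T b₂ → ¬ γ D S T b₁ b₂ →
          let S₁ = Block D T S a₁
              S₂ = Block D T S a₂
              T₁ = Block D S T b₁
              T₂ = Block D S T b₂
          in (S₁ ⇉[ D ] T₁ × T₁ ⇉[ D ] S₂ × S₂ ⇉[ D ] T₂ × T₂ ⇉[ D ] S₁)
           ⊎ (T₁ ⇉[ D ] S₁ × S₁ ⇉[ D ] T₂ × T₂ ⇉[ D ] S₂ × S₂ ⇉[ D ] T₁))
lemma5p9 D hh rf _ _ s t s≁t S⇄T =
    γ-isEquivalence , γ⇔commonNbr-everywhere , γ⇔commonNbr-somewhere , γ-numClasses , blocks-cycle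
  where
  open Homogeneous D hh rf
  open Pair s t s≁t S⇄T
  open Blocks s t s≁t S⇄T
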